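{- Let $T = \langle S, Act, \to\rangle$ be a labelled transition system. Then for all states $s, s' \in S$: $s$ and $s'$ are similar in $T$ if and only if $s$ and $s'$ are similar in the Kripke structure $\mathsf{ks}(T)$.
   Context: A Kripke structure is $K=\langle S, AP, \to, L\rangle$ with $S$ a set of states, $AP$ a set of atomic propositions, $\to\,\subseteq S\times S$ a total transition relation (for every $s\in S$ there is $t\in S$ with $s\to t$), and $L: S\to 2^{AP}$ a state labelling. A labelled transition system (LTS) is $T=\langle S, Act, \to\rangle$ with $S$ a set of states, $Act$ a set of actions, a special silent action $\tau\notin Act$, and a transition relation $\to\,\subseteq S\times(Act\cup\{\tau\})\times S$ that is total (for every $s\in S$ there are $a\in Act$, $t\in S$ with $s\xrightarrow{a}t$). The embedding $\mathsf{ks}$: for an LTS $T=\langle S,Act,\to\rangle$, $\mathsf{ks}(T)=\langle S', AP, \to', L\rangle$ where $S' = S\cup\{(s,a,t)\in\,\to \mid a\neq\tau\}$ (the non-$\tau$ transitions become states), $AP = Act\cup\{\bot\}$ with $\bot\notin Act$ fresh, $\to'$ is the least relation such that for every transition $(s,a,t)$ with $a\neq\tau$ we have $s\to'(s,a,t)$ and $(s,a,t)\to' t$, and $s\to' t$ whenever $s\xrightarrow{\tau}t$; and $L(s)=\{\bot\}$ for $s\in S$, $L((s,a,t))=\{a\}$. Simulation in a Kripke structure: a relation $B\subseteq S\times S$ is a simulation iff for all $(s,s')\in B$: $L(s)=L(s')$, and for every $t$ with $s\to t$ there is $t'$ with $s'\to t'$ and $(t,t')\in B$. Simulation in an LTS: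 $B\subseteq S\times S$ is a simulation iff for all $(s,s')\in B$, all $a\in Act\cup\{\tau\}$ and all $t$ with $s\xrightarrow{a}t$ there is $t'$ with $s'\xrightarrow{a}t'$ and $(t,t')\in B$. In either setting, states $s,s'$ are similar iff there are simulations $B$, $B'$ with $(s,s')\in B$ and $(s',s)\in B'$. -}

module Defs where

open import Level using (Level; _⊔_; suc)
open import Data.Maybe using (Maybe; just; nothing)
open import Data.Product using (Σ; ∃; ∃-syntax; _×_; _,_)
open import Data.Sum using (_⊎_; inj₁; inj₂)
open import Relation.Binary.PropositionalEquality using (_≡_)
open import Function.Bundles using (_⇔_)

-- Labels of an LTS: `nothing` is the silent action τ, `just a` is a ∈ Act.
-- Thus τ ∉ Act holds by construction.

record LTS (ℓ : Level) : Set (suc ℓ) where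
  field
    State : Set ℓ
    Act   : Set ℓ
    _⟶[_]_ : State → Maybe Act → State → Set ℓ
    total : ∀ s → ∃[ a ] ∃[ t ] (s ⟶[ just a ] t)

-- A set of atomic propositions is represented as a predicate on AP;
-- equality of label sets is extensional equality of these predicates.
record Kripke (ℓ : Level) : Set (suc ℓ) where
  field
    State : Set ℓ
    AP    : Set ℓ
    _⟶_   : State → State → Set ℓ
    total : ∀ s → ∃[ t ] (s ⟶ t)
    L     : State → AP → Set ℓ

module _ {ℓ} (K : Kripke ℓ) where
  open Kripke K
  SameLabel : State → State → Set ℓ
  SameLabel s s' = ∀ p → (L s p ⇔ L s' p)

  IsSimulationK : (State → State → Set ℓ) → Set ℓ
  IsSimulationK B = ∀ {s s'} → B s s' →
    SameLabel s s' × (∀ {t} → s ⟶ t → ∃[ t' ] (s' ⟶ t' × B t t'))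

  SimilarK : State → State → Set (suc ℓ)
  SimilarK s s' =
    (∃[ B ] (IsSimulationK B × B s s')) × (∃[ B' ] (IsSimulationK B' × B' s' s))

module _ {ℓ} (T : LTS ℓ) where
  open LTS T
  IsSimulationL : (State → State → Set ℓ) → Set ℓ
  IsSimulationL B = ∀ {s s'} → B s s' →
    ∀ (a : Maybe Act) {t} → s ⟶[ a ] t → ∃[ t' ] (s' ⟶[ a ] t' × B t t')

  SimilarL : State → State → Set (suc ℓ)
  SimilarL s s' =
    (∃[ B ] (IsSimulationL B × B s s')) × (∃[ B' ] (IsSimulationL B' × B' s' s))

module KS {ℓ} (T : LTS ℓ) where
  open LTS T

  Trans : Set ℓ
  Trans = Σ State λ s → Σ Act λ a → Σ State λ t → s ⟶[ just a ] t

  KState : Set ℓ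
  KState = State ⊎ Trans

  -- AP = Act ∪ {⊥}, ⊥ fresh: represented as Maybe Act with nothing = ⊥
  KAP : Set ℓ
  KAP = Maybe Act

  data _⟶'_ : KState → KState → Set ℓ where
    into  : ∀ {s a t} (p : s ⟶[ just a ] t) → inj₁ s ⟶' inj₂ (s , a , t , p)
    outof : ∀ {s a t} (p : s ⟶[ just a ] t) → inj₂ (s , a , t , p) ⟶' inj₁ t
    silent : ∀ {s t} → s ⟶[ nothing ] t → inj₁ s ⟶' inj₁ t

  Lab : KState → KAP → Set ℓ
  Lab (inj₁ s) p = p ≡ nothing
  Lab (inj₂ (s , a , t , _)) p = p ≡ just a

  ktotal : ∀ x → ∃[ y ] (x ⟶' y)
  ktotal (inj₁ s) with total s
  ... | a , t , p = inj₂ (s , a , t , p) , into p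
  ktotal (inj₂ (s , a , t , p)) = inj₁ t , outof p

ks : ∀ {ℓ} → LTS ℓ → Kripke ℓ
ks T = record
  { State = KState ; AP = KAP ; _⟶_ = _⟶'_ ; total = ktotal ; L = Lab }
  where open KS T

module Submission where

-- Both directions transport a witnessing simulation along the embedding.
--  * From T to ks T: an LTS simulation B lifts to the relation `Lift B`
--    relating two states of T when B relates them, and two transition-states
--    with the same action when B relates their targets.  A τ-step of ks T is a
--    τ-step of T, a step into (s,a,t) is an a-step of T, and a step out of
--    (s,a,t) goes to t, so `Lift B` is a Kripke simulation.
--  * From ks T to T: a Kripke simulation R restricts to `Restrict R`, its
--    part on states of T.  Since R preserves labels, the answer to a τ-step
--    cannot be a step into a transition-state (label ⊥ versus an action), and
--    the answer to a step into (s,a,t) must be a step into some (s',a,t');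
--    following both out of their transition-states gives the a-step of T.

open import Defs
open import Level using (Level)
open import Data.Sum using (inj₁; inj₂)
open import Data.Product using (∃-syntax; _×_; _,_; proj₁; proj₂)
open import Data.Maybe using (just; nothing)
open import Function.Bundles using (_⇔_; mk⇔; Equivalence)
open import Relation.Binary.PropositionalEquality using (refl)

module Embedding {ℓ} (T : LTS ℓ) where
  open LTS T
  open KS T

  data Lift (B : State → State → Set ℓ) : KState → KState → Set ℓ where
    state : ∀ {s s'} → B s s' → Lift B (inj₁ s) (inj₁ s')
    trans : ∀ {s a t p s' t' p'} → B t t' →
            Lift B (inj₂ (s , a , t , p)) (inj₂ (s' , a , t' , p'))

  -- Lifted pairs carry literally the same label (⊥, or the shared action).
  lift-sameLabel : ∀ {B x y} → Lift B x y → SameLabel (ks T) x y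
  lift-sameLabel (state _) _ = mk⇔ (λ l → l) (λ l → l)
  lift-sameLabel (trans _) _ = mk⇔ (λ l → l) (λ l → l)

  lift-isSimulation : ∀ {B} → IsSimulationL T B → IsSimulationK (ks T) (Lift B)
  lift-isSimulation {B} sim b = lift-sameLabel b , answer b
    where
    answer : ∀ {x y z} → Lift B x y → x ⟶' z → ∃[ z' ] (y ⟶' z' × Lift B z z')
    answer (state b) (into p) with sim b _ p
    ... | t' , q , b' = inj₂ (_ , _ , t' , q) , into q , trans b'
    answer (state b) (silent p) with sim b _ p
    ... | t' , q , b' = inj₁ t' , silent q , state b'
    answer (trans b) (outof _) = _ , outof _ , state b

  Restrict : (KState → KState → Set ℓ) → State → State → Set ℓ
  Restrict R s s' = R (inj₁ s) (inj₁ s')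

  module FromKripke {R : KState → KState → Set ℓ}
                    (sim : IsSimulationK (ks T) R) where

    label-transfer : ∀ {x y} → R x y → ∀ p → Lab x p → Lab y p
    label-transfer r p = Equivalence.to (proj₁ (sim r) p)

    -- A τ-step of T is answered by a τ-step: a step into a transition-state
    -- would relate the ⊥-labelled target to an action-labelled state.
    silent-answer : ∀ {s s' t} → R (inj₁ s) (inj₁ s') → s ⟶[ nothing ] t →
                    ∃[ t' ] (s' ⟶[ nothing ] t' × R (inj₁ t) (inj₁ t'))
    silent-answer r p with proj₂ (sim r) (silent p)
    ... | inj₁ t' , silent q , r' = t' , q , r'
    ... | inj₂ _ , into _ , r' with label-transfer r' nothing refl
    ...   | ()

    -- Related transition-states have related targets: leaving (s,a,t) must be
    -- answered by leaving the partner transition-state.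
    target-answer : ∀ {s a t p s' a' t' p'} →
                    R (inj₂ (s , a , t , p)) (inj₂ (s' , a' , t' , p')) →
                    R (inj₁ t) (inj₁ t')
    target-answer r with proj₂ (sim r) (outof _)
    ... | _ , outof _ , r' = r'

    -- An a-step of T is answered by an a-step: the step into (s,a,t) must be
    -- answered by a step into a transition-state carrying the same action a.
    visible-answer : ∀ {s s' t a} → R (inj₁ s) (inj₁ s') → s ⟶[ just a ] t →
                     ∃[ t' ] (s' ⟶[ just a ] t' × R (inj₁ t) (inj₁ t'))
    visible-answer {a = a} r p with proj₂ (sim r) (into p)
    ... | inj₁ _ , silent _ , r' with label-transfer r' (just a) refl
    ...   | ()
    visible-answer {a = a} r p | inj₂ _ , into q , r'
      with label-transfer r' (just a) refl
    ...   | refl = _ , q , target-answer r'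

    restrict-isSimulation : IsSimulationL T (Restrict R)
    restrict-isSimulation r nothing  p = silent-answer r p
    restrict-isSimulation r (just _) p = visible-answer r p

  open FromKripke using (restrict-isSimulation)

  similarL⇒similarK : ∀ {s s'} → SimilarL T s s' → SimilarK (ks T) (inj₁ s) (inj₁ s')
  similarL⇒similarK ((B , simB , b) , (B' , simB' , b')) =
    (Lift B , lift-isSimulation simB , state b) ,
    (Lift B' , lift-isSimulation simB' , state b')

  similarK⇒similarL : ∀ {s s'} → SimilarK (ks T) (inj₁ s) (inj₁ s') → SimilarL T s s'
  similarK⇒similarL ((R , simR , r) , (R' , simR' , r')) =
    (Restrict R , restrict-isSimulation simR , r) ,
    (Restrict R' , restrict-isSimulation simR' , r')

theorem3p6 : ∀ {ℓ : Level} (T : LTS ℓ) (s s' : LTS.State T) →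
    SimilarL T s s' ⇔ SimilarK (ks T) (inj₁ s) (inj₁ s')
theorem3p6 T s s' = mk⇔ similarL⇒similarK similarK⇒similarL
  where open Embedding T
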